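{- Let $G=(V,E)$ be a König–Egerváry graph, let $G_0=G-N[\mathrm{core}(G)]$, and let $S\in\Omega(G)$. Then: (i) $|\mathrm{core}(G)|\ge |N(\mathrm{core}(G))|$; (ii) $|S-\mathrm{core}(G)|=|V-S-N(\mathrm{core}(G))|$; (iii) $G_0$ has a perfect matching and $G_0$ is a König–Egerváry graph.
   Context: All graphs are finite and simple; "graph" means a connected graph with at least one edge (derived subgraphs such as $G_0$ need not be connected; the definitions below apply to them as well). $\alpha(G)$ is the stability number, $\mu(G)$ the maximum matching size, $n(G)=|V(G)|$; $G$ is König–Egerváry if $\alpha(G)+\mu(G)=n(G)$. $\Omega(G)$ is the set of maximum stable sets of $G$, and $\mathrm{core}(G)=\bigcap\{S:S\in\Omega(G)\}$. For $A\subseteq V$, $N(A)$ is the set of vertices adjacent to some vertex of $A$, and $N[A]=A\cup N(A)$. For $W\subseteq V$, $G-W$ is the subgraph induced by $V-W$. -}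

module Defs where

open import Data.Nat using (ℕ; _+_; _≤_)
open import Data.Bool using (Bool; true; false; _∧_; _∨_)
open import Data.Fin using (Fin; zero; suc)
open import Data.Fin.Subset using (Subset; _∈_; _∉_; ⊤; ∣_∣)
open import Data.Vec using (tabulate; lookup)
open import Data.List using (List; length; concatMap; _∷_; [])
open import Data.List.Relation.Unary.All using (All)
open import Data.List.Relation.Unary.Unique.Propositional using (Unique)
import Data.List.Membership.Propositional as LM
open import Data.Product using (Σ; ∃; _×_; _,_; proj₁; proj₂)
open import Relation.Binary.PropositionalEquality using (_≡_)
open import Relation.Nullary using (¬_)

record Graph (n : ℕ) : Set where
  field
    adj     : Fin n → Fin n → Bool
    adj-sym : ∀ u v → adj u v ≡ adj v u
    adj-irr : ∀ v → adj v v ≡ false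
open Graph public

module _ {n : ℕ} (G : Graph n) where

  Edge : Fin n → Fin n → Set
  Edge u v = adj G u v ≡ true

  data Reach : Fin n → Fin n → Set where
    here : ∀ {v} → Reach v v
    step : ∀ {u w v} → Edge u w → Reach w v → Reach u v

  Connected : Set
  Connected = ∀ u v → Reach u v

  HasEdge : Set
  HasEdge = ∃ λ u → ∃ λ v → Edge u v

  -- "graph" in the paper's sense: connected with at least one edge
  IsGraph : Set
  IsGraph = Connected × HasEdge

  anyV : ∀ {m} → (Fin m → Bool) → Bool
  anyV {ℕ.zero}  p = false
  anyV {ℕ.suc m} p = p zero ∨ anyV (λ i → p (suc i))

  N : Subset n → Subset n
  N A = tabulate (λ v → anyV (λ u → lookup A u ∧ adj G u v))

  -- All notions below are relative to the induced subgraph G[W]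
  -- on the vertex set W ⊆ V; the graph G itself is G[⊤].

  IsStableIn : Subset n → Subset n → Set
  IsStableIn W S = (∀ v → v ∈ S → v ∈ W) × (∀ u v → u ∈ S → v ∈ S → ¬ Edge u v)

  IsMaxStableIn : Subset n → Subset n → Set
  IsMaxStableIn W S = IsStableIn W S × (∀ T → IsStableIn W T → ∣ T ∣ ≤ ∣ S ∣)

  endpoints : List (Fin n × Fin n) → List (Fin n)
  endpoints = concatMap (λ e → proj₁ e ∷ proj₂ e ∷ [])

  -- M is a matching of G[W]: a list of edges of G[W] with pairwise
  -- distinct endpoints (hence pairwise disjoint edges, no repeated edge)
  IsMatchingIn : Subset n → List (Fin n × Fin n) → Set
  IsMatchingIn W M =
    All (λ e → Edge (proj₁ e) (proj₂ e) × proj₁ e ∈ W × proj₂ e ∈ W) M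
    × Unique (endpoints M)

  IsMaxMatchingIn : Subset n → List (Fin n × Fin n) → Set
  IsMaxMatchingIn W M =
    IsMatchingIn W M × (∀ M' → IsMatchingIn W M' → length M' ≤ length M)

  HasPerfectMatchingIn : Subset n → Set
  HasPerfectMatchingIn W =
    Σ (List (Fin n × Fin n)) λ M →
      IsMatchingIn W M × (∀ v → v ∈ W → v LM.∈ endpoints M)

  IsKEIn : Subset n → Set
  IsKEIn W =
    Σ (Subset n) λ S → Σ (List (Fin n × Fin n)) λ M →
      IsMaxStableIn W S × IsMaxMatchingIn W M × (∣ S ∣ + length M ≡ ∣ W ∣)

  IsKE : Set
  IsKE = IsKEIn ⊤

  IsCore : Subset n → Set
  IsCore C = ∀ v → (v ∈ C → ∀ S → IsMaxStableIn ⊤ S → v ∈ S)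
                 × ((∀ S → IsMaxStableIn ⊤ S → v ∈ S) → v ∈ C)

{-# OPTIONS --safe #-}
module Submission where

-- Let M be a maximum matching, so that |S| + |M| = n for every maximum stable set S. Counting the
-- ends of M outside S shows that M matches V − S into S: every edge of M has exactly one end in S,
-- and every vertex outside S is matched. Hence the mate of a vertex of N(core) lies in every
-- maximum stable set, i.e. in the core, while every vertex outside the core is matched. So M
-- matches N(core) into core and S − core onto V − S − N(core), and the edges of M inside
-- G₀ = G − N[core] form a perfect matching of G₀, in which S − core is a maximum stable set
-- because the core can be added to any stable set of G₀.

open import Defs
open import Function using (_∘_)
open import Data.Nat using (ℕ; zero; suc; _+_; _*_; _∸_; _≤_; _<_; z≤n)
open import Data.Nat.Properties
  using ( ≤-refl; ≤-reflexive; ≤-trans; ≤-antisym; <-irrefl; +-comm; +-assoc; +-suc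
        ; +-identityʳ; *-identityˡ; *-zeroʳ; *-suc; +-mono-≤; +-monoˡ-≤; +-monoʳ-≤; +-cancelˡ-≤
        ; +-cancelʳ-≤; *-cancelˡ-≤; m≤m+n; m≤n+m; m+n∸m≡n; 1+n≢n; module ≤-Reasoning)
open import Data.Bool using (Bool; true; false; _∧_; _∨_)
open import Data.Bool.Properties using (∧-conicalˡ; ∧-conicalʳ; ∨-zeroʳ)
open import Data.Fin using (Fin; zero; suc; _≟_)
open import Data.Fin.Subset
  using (Subset; inside; outside; _∈_; _∉_; Empty; ⊤; ∁; ⁅_⁆; _∩_; _∪_; _─_; _-_; ∣_∣)
open import Data.Fin.Subset.Properties
  using ( _∈?_; ∈⊤; drop-there; Empty-unique; ∣⊥∣≡0; ∣⊤∣≡n; ∣⁅x⁆∣≡1; x∉⁅y⁆⇒x≢y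
        ; p⊆q⇒∣p∣≤∣q∣; x∉p⇒x∈∁p; x∉∁p⇒x∈p; ∣∁p∣≡n∸∣p∣; ∣p∩q∣≤∣q∣; x∈p∩q⁺
        ; x∈p∪q⁺; x∈p∪q⁻; x∈p∧x∉q⇒x∈p─q; p─q⊆p; ∣p─q∣≤∣p∣; x∈p∧x≢y⇒x∈p-y
        ; x∈p⇒∣p-x∣<∣p∣)
open import Data.Vec using (_∷_; [])
import Data.Vec as Vec
open import Data.Vec.Properties using (lookup∘tabulate; lookup⇒[]=; []=⇒lookup)
open import Data.List using (List; _∷_; []; length; filter)
import Data.List.Relation.Unary.All as All
open import Data.List.Relation.Unary.Any using (here; there)
open import Data.List.Relation.Unary.AllPairs using (_∷_)
open import Data.List.Relation.Unary.Unique.Propositional using (Unique)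
import Data.List.Relation.Unary.Unique.Propositional.Properties as Unique
open import Data.List.Membership.Propositional using () renaming (_∈_ to _∈ₗ_)
open import Data.List.Membership.Propositional.Properties using (∈-filter⁺; ∈-filter⁻)
open import Data.Product using (∃; _×_; _,_; proj₁; proj₂)
import Data.Product as Product
open import Data.Sum using (_⊎_; inj₁; inj₂; swap)
import Data.Sum as Sum
open import Data.Empty using (⊥-elim)
open import Relation.Nullary using (¬_; yes; no)
open import Relation.Nullary.Decidable using (decidable-stable)
open import Relation.Binary.PropositionalEquality
  using (_≡_; refl; sym; trans; cong; cong₂; subst; ≢-sym)

open ≤-Reasoning

∣p∣≡∣p─q∣+∣p∩q∣ : ∀ {n} (p q : Subset n) → ∣ p ∣ ≡ ∣ p ─ q ∣ + ∣ p ∩ q ∣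
∣p∣≡∣p─q∣+∣p∩q∣ []            []            = refl
∣p∣≡∣p─q∣+∣p∩q∣ (outside ∷ p) (outside ∷ q) = ∣p∣≡∣p─q∣+∣p∩q∣ p q
∣p∣≡∣p─q∣+∣p∩q∣ (outside ∷ p) (inside  ∷ q) = ∣p∣≡∣p─q∣+∣p∩q∣ p q
∣p∣≡∣p─q∣+∣p∩q∣ (inside  ∷ p) (outside ∷ q) = cong suc (∣p∣≡∣p─q∣+∣p∩q∣ p q)
∣p∣≡∣p─q∣+∣p∩q∣ (inside  ∷ p) (inside  ∷ q) =
  trans (cong suc (∣p∣≡∣p─q∣+∣p∩q∣ p q)) (sym (+-suc _ _))

∣p∣≤∣p─q∣+∣q∣ : ∀ {n} (p q : Subset n) → ∣ p ∣ ≤ ∣ p ─ q ∣ + ∣ q ∣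
∣p∣≤∣p─q∣+∣q∣ p q = begin
  ∣ p ∣                   ≡⟨ ∣p∣≡∣p─q∣+∣p∩q∣ p q ⟩
  ∣ p ─ q ∣ + ∣ p ∩ q ∣   ≤⟨ +-monoʳ-≤ ∣ p ─ q ∣ (∣p∩q∣≤∣q∣ p q) ⟩
  ∣ p ─ q ∣ + ∣ q ∣       ∎

∣p∣+∣q∣≤∣p∪q∣ : ∀ {n} {p q : Subset n} → (∀ {x} → x ∈ p → x ∉ q) → ∣ p ∣ + ∣ q ∣ ≤ ∣ p ∪ q ∣
∣p∣+∣q∣≤∣p∪q∣ {p = p} {q} disjoint = begin
  ∣ p ∣ + ∣ q ∣                     ≤⟨ +-mono-≤ (p⊆q⇒∣p∣≤∣q∣ p⊆p∪q─q) (p⊆q⇒∣p∣≤∣q∣ q⊆p∪q∩q) ⟩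
  ∣ (p ∪ q) ─ q ∣ + ∣ (p ∪ q) ∩ q ∣ ≡⟨ sym (∣p∣≡∣p─q∣+∣p∩q∣ (p ∪ q) q) ⟩
  ∣ p ∪ q ∣                         ∎
  where
  p⊆p∪q─q : ∀ {x} → x ∈ p → x ∈ (p ∪ q) ─ q
  p⊆p∪q─q x∈p = x∈p∧x∉q⇒x∈p─q (x∈p∪q⁺ (inj₁ x∈p)) (disjoint x∈p)
  q⊆p∪q∩q : ∀ {x} → x ∈ q → x ∈ (p ∪ q) ∩ q
  q⊆p∪q∩q x∈q = x∈p∩q⁺ (x∈p∪q⁺ (inj₂ x∈q) , x∈q)

x∈p─q⁻ : ∀ {n} {x : Fin n} (p q : Subset n) → x ∈ p ─ q → x ∈ p × x ∉ q
x∈p─q⁻ (_ ∷ p) (outside ∷ q) Vec.here = Vec.here , λ ()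
x∈p─q⁻ (s ∷ p) (t ∷ q) (Vec.there x∈p─q) =
  Product.map Vec.there (λ x∉q → x∉q ∘ drop-there) (x∈p─q⁻ p q x∈p─q)

module _ {n : ℕ} where

  indicator : Subset n → Fin n → ℕ
  indicator p x with x ∈? p
  ... | yes _ = 1
  ... | no  _ = 0

  indicator-∈ : ∀ {p x} → x ∈ p → indicator p x ≡ 1
  indicator-∈ {p} {x} x∈p with x ∈? p
  ... | yes _   = refl
  ... | no  x∉p = ⊥-elim (x∉p x∈p)

  indicator-∉ : ∀ {p x} → x ∉ p → indicator p x ≡ 0
  indicator-∉ {p} {x} x∉p with x ∈? p
  ... | yes x∈p = ⊥-elim (x∉p x∈p)
  ... | no  _   = refl

  indicator-mono : ∀ {p q x y} → (x ∈ p → y ∈ q) → indicator p x ≤ indicator q y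
  indicator-mono {p} {q} {x} {y} x∈p⇒y∈q with x ∈? p | y ∈? q
  ... | yes x∈p | no y∉q = ⊥-elim (y∉q (x∈p⇒y∈q x∈p))
  ... | yes _   | yes _  = ≤-refl
  ... | no  _   | _      = z≤n

  ∣p∣≡indicator+∣p-x∣ : ∀ (p : Subset n) x → ∣ p ∣ ≡ indicator p x + ∣ p - x ∣
  ∣p∣≡indicator+∣p-x∣ p x with x ∈? p
  ... | yes x∈p = ≤-antisym
    (begin
      ∣ p ∣               ≤⟨ ∣p∣≤∣p─q∣+∣q∣ p ⁅ x ⁆ ⟩
      ∣ p - x ∣ + ∣ ⁅ x ⁆ ∣ ≡⟨ cong (∣ p - x ∣ +_) (∣⁅x⁆∣≡1 x) ⟩
      ∣ p - x ∣ + 1       ≡⟨ +-comm ∣ p - x ∣ 1 ⟩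
      1 + ∣ p - x ∣       ∎)
    (x∈p⇒∣p-x∣<∣p∣ x∈p)
  ... | no  x∉p = ≤-antisym
    (p⊆q⇒∣p∣≤∣q∣ {p = p} {p - x} (λ y∈p → x∈p∧x≢y⇒x∈p-y y∈p λ { refl → x∉p y∈p }))
    (∣p─q∣≤∣p∣ p ⁅ x ⁆)

  count : Subset n → List (Fin n) → ℕ
  count p []       = 0
  count p (x ∷ xs) = indicator p x + count p xs

  count-mono : ∀ {p q} xs → (∀ {x} → x ∈ₗ xs → x ∈ p → x ∈ q) → count p xs ≤ count q xs
  count-mono []       _   = z≤n
  count-mono (x ∷ xs) p⊆q =
    +-mono-≤ (indicator-mono (p⊆q (here refl))) (count-mono xs (p⊆q ∘ there))

  count≤∣p∣ : ∀ {xs} → Unique xs → ∀ p → count p xs ≤ ∣ p ∣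
  count≤∣p∣ {[]}     _                   p = z≤n
  count≤∣p∣ {x ∷ xs} (x∉xs ∷ xs-unique) p = begin
    indicator p x + count p xs         ≤⟨ +-monoʳ-≤ _ (count-mono xs p⊆p-x) ⟩
    indicator p x + count (p - x) xs   ≤⟨ +-monoʳ-≤ _ (count≤∣p∣ xs-unique (p - x)) ⟩
    indicator p x + ∣ p - x ∣          ≡⟨ sym (∣p∣≡indicator+∣p-x∣ p x) ⟩
    ∣ p ∣                              ∎
    where
    p⊆p-x : ∀ {y} → y ∈ₗ xs → y ∈ p → y ∈ p - x
    p⊆p-x y∈xs y∈p = x∈p∧x≢y⇒x∈p-y y∈p (≢-sym (All.lookup x∉xs y∈xs))

  ∣p∣≤count : ∀ xs p → (∀ x → x ∈ p → x ∈ₗ xs) → ∣ p ∣ ≤ count p xs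
  ∣p∣≤count []       p covered = ≤-reflexive (trans (cong ∣_∣ (Empty-unique empty)) (∣⊥∣≡0 n))
    where
    empty : Empty p
    empty (x , x∈p) with covered x x∈p
    ... | ()
  ∣p∣≤count (x ∷ xs) p covered = begin
    ∣ p ∣                              ≡⟨ ∣p∣≡indicator+∣p-x∣ p x ⟩
    indicator p x + ∣ p - x ∣          ≤⟨ +-monoʳ-≤ _ (∣p∣≤count xs (p - x) p-x⊆xs) ⟩
    indicator p x + count (p - x) xs   ≤⟨ +-monoʳ-≤ _ (count-mono xs (λ _ → p─q⊆p p ⁅ x ⁆)) ⟩
    indicator p x + count p xs         ∎
    where
    p-x⊆xs : ∀ y → y ∈ p - x → y ∈ₗ xs
    p-x⊆xs y y∈p-x with x∈p─q⁻ p ⁅ x ⁆ y∈p-x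
    ... | y∈p , y∉⁅x⁆ with covered y y∈p
    ...   | here y≡x    = ⊥-elim (x∉⁅y⁆⇒x≢y y∉⁅x⁆ y≡x)
    ...   | there y∈xs = y∈xs

  endsIn : Subset n → Fin n × Fin n → ℕ
  endsIn p (x , y) = indicator p x + indicator p y

  endsIn≡1⇒∉ʳ : ∀ {p x y} → endsIn p (x , y) ≡ 1 → x ∈ p → y ∉ p
  endsIn≡1⇒∉ʳ one x∈p y∈p = 1+n≢n (trans (sym (cong₂ _+_ (indicator-∈ x∈p) (indicator-∈ y∈p))) one)

  endsIn≡1⇒∉ˡ : ∀ {p x y} → endsIn p (x , y) ≡ 1 → y ∈ p → x ∉ p
  endsIn≡1⇒∉ˡ one y∈p x∈p = endsIn≡1⇒∉ʳ one x∈p y∈p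

  Mates : List (Fin n × Fin n) → Fin n → Fin n → Set
  Mates M x y = (x , y) ∈ₗ M ⊎ (y , x) ∈ₗ M

  _↾_ : List (Fin n × Fin n) → Subset n → List (Fin n × Fin n)
  M ↾ W = filter (λ e → proj₁ e ∈? W) M

module _ {n : ℕ} (G : Graph n) where

  edge-sym : ∀ {u v} → Edge G u v → Edge G v u
  edge-sym {u} {v} = trans (adj-sym G v u)

  anyV-intro : ∀ {m} (p : Fin m → Bool) i → p i ≡ true → anyV G p ≡ true
  anyV-intro p zero    pi≡true = cong (_∨ anyV G (p ∘ suc)) pi≡true
  anyV-intro p (suc i) pi≡true =
    trans (cong (p zero ∨_) (anyV-intro (p ∘ suc) i pi≡true)) (∨-zeroʳ (p zero))

  anyV-elim : ∀ {m} (p : Fin m → Bool) → anyV G p ≡ true → ∃ λ i → p i ≡ true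
  anyV-elim {suc m} p any with p zero in p0
  ... | true  = zero , p0
  ... | false = let i , pi≡true = anyV-elim (p ∘ suc) any in suc i , pi≡true

  ∈N⁺ : ∀ {A u v} → u ∈ A → Edge G u v → v ∈ N G A
  ∈N⁺ {A} {u} {v} u∈A uv = lookup⇒[]= v (N G A)
    (trans (lookup∘tabulate _ v) (anyV-intro _ u (cong₂ _∧_ ([]=⇒lookup u∈A) uv)))

  ∈N⁻ : ∀ {A v} → v ∈ N G A → ∃ λ u → u ∈ A × Edge G u v
  ∈N⁻ {A} {v} v∈N with anyV-elim _ (trans (sym (lookup∘tabulate _ v)) ([]=⇒lookup v∈N))
  ... | u , u∈A∧uv = u , lookup⇒[]= u A (∧-conicalˡ _ _ u∈A∧uv) , ∧-conicalʳ _ _ u∈A∧uv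

  stable-∪ : ∀ {A B} → IsStableIn G ⊤ A → IsStableIn G ⊤ B → (∀ {v} → v ∈ A → v ∉ N G B) →
             IsStableIn G ⊤ (A ∪ B)
  stable-∪ {A} {B} (_ , A-indep) (_ , B-indep) A∩N[B]≡∅ = (λ _ _ → ∈⊤) , indep
    where
    indep : ∀ u v → u ∈ A ∪ B → v ∈ A ∪ B → ¬ Edge G u v
    indep u v u∈ v∈ uv with x∈p∪q⁻ A B u∈ | x∈p∪q⁻ A B v∈
    ... | inj₁ u∈A | inj₁ v∈A = A-indep u v u∈A v∈A uv
    ... | inj₁ u∈A | inj₂ v∈B = A∩N[B]≡∅ u∈A (∈N⁺ v∈B (edge-sym uv))
    ... | inj₂ u∈B | inj₁ v∈A = A∩N[B]≡∅ v∈A (∈N⁺ u∈B uv)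
    ... | inj₂ u∈B | inj₂ v∈B = B-indep u v u∈B v∈B uv

  maxStable-size : ∀ {W S T} → IsMaxStableIn G W S → IsMaxStableIn G W T → ∣ S ∣ ≡ ∣ T ∣
  maxStable-size (S-stable , S-max) (T-stable , T-max) =
    ≤-antisym (T-max _ S-stable) (S-max _ T-stable)

  mates⇒edge : ∀ {W M x y} → IsMatchingIn G W M → Mates M x y → Edge G x y
  mates⇒edge (edges , _) (inj₁ xy∈M) = proj₁ (All.lookup edges xy∈M)
  mates⇒edge (edges , _) (inj₂ yx∈M) = edge-sym (proj₁ (All.lookup edges yx∈M))

  Covers : List (Fin n × Fin n) → Subset n → Set
  Covers M p = ∀ v → v ∈ p → v ∈ₗ endpoints G M

  count-endpoints-∷ : ∀ p e M → count p (endpoints G (e ∷ M)) ≡ endsIn p e + count p (endpoints G M)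
  count-endpoints-∷ p (x , y) M = sym (+-assoc (indicator p x) (indicator p y) _)

  count-endpoints-mono : ∀ {p q} M → (∀ {e} → e ∈ₗ M → endsIn p e ≤ endsIn q e) →
                         count p (endpoints G M) ≤ count q (endpoints G M)
  count-endpoints-mono         []      _   = z≤n
  count-endpoints-mono {p} {q} (e ∷ M) p≤q = begin
    count p (endpoints G (e ∷ M))         ≡⟨ count-endpoints-∷ p e M ⟩
    endsIn p e + count p (endpoints G M)
      ≤⟨ +-mono-≤ (p≤q (here refl)) (count-endpoints-mono M (p≤q ∘ there)) ⟩
    endsIn q e + count q (endpoints G M)  ≡⟨ count-endpoints-∷ q e M ⟨
    count q (endpoints G (e ∷ M))         ∎

  count-endpoints-≡ : ∀ {p k} M → (∀ {e} → e ∈ₗ M → endsIn p e ≡ k) →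
                      count p (endpoints G M) ≡ k * length M
  count-endpoints-≡ {k = k} []      _    = sym (*-zeroʳ k)
  count-endpoints-≡ {p} {k} (e ∷ M) ends = begin-equality
    count p (endpoints G (e ∷ M))         ≡⟨ count-endpoints-∷ p e M ⟩
    endsIn p e + count p (endpoints G M)
      ≡⟨ cong₂ _+_ (ends (here refl)) (count-endpoints-≡ M (ends ∘ there)) ⟩
    k + k * length M                      ≡⟨ *-suc k (length M) ⟨
    k * length (e ∷ M)                    ∎

  length≤count-endpoints : ∀ {p} M → (∀ {e} → e ∈ₗ M → 1 ≤ endsIn p e) →
                           length M ≤ count p (endpoints G M)
  length≤count-endpoints     []      _   = z≤n
  length≤count-endpoints {p} (e ∷ M) hit = begin
    1 + length M
      ≤⟨ +-mono-≤ (hit (here refl)) (length≤count-endpoints M (hit ∘ there)) ⟩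
    endsIn p e + count p (endpoints G M)  ≡⟨ count-endpoints-∷ p e M ⟨
    count p (endpoints G (e ∷ M))         ∎

  endsIn≡1 : ∀ {p} M → (∀ {e} → e ∈ₗ M → 1 ≤ endsIn p e) → count p (endpoints G M) ≤ length M →
             ∀ {e} → e ∈ₗ M → endsIn p e ≡ 1
  endsIn≡1 {p} (e ∷ M) hit bound = λ
    { (here refl)  → ≤-antisym (+-cancelʳ-≤ (length M) (endsIn p e) 1 (≤-trans head-bound split-bound))
                               (hit (here refl))
    ; (there e∈M) → endsIn≡1 M (hit ∘ there) (+-cancelˡ-≤ 1 _ _ (≤-trans tail-bound split-bound)) e∈M
    }
    where
    split-bound : endsIn p e + count p (endpoints G M) ≤ 1 + length M
    split-bound = ≤-trans (≤-reflexive (sym (count-endpoints-∷ p e M))) bound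
    head-bound : endsIn p e + length M ≤ endsIn p e + count p (endpoints G M)
    head-bound = +-monoʳ-≤ (endsIn p e) (length≤count-endpoints M (hit ∘ there))
    tail-bound : 1 + count p (endpoints G M) ≤ endsIn p e + count p (endpoints G M)
    tail-bound = +-monoˡ-≤ _ (hit (here refl))

  ∣p∣≡k*length : ∀ {p k M} → Unique (endpoints G M) → Covers M p →
                 (∀ {e} → e ∈ₗ M → endsIn p e ≡ k) → ∣ p ∣ ≡ k * length M
  ∣p∣≡k*length {p} {k} {M} unique covers ends = ≤-antisym
    (begin
      ∣ p ∣                    ≤⟨ ∣p∣≤count _ p covers ⟩
      count p (endpoints G M)  ≡⟨ count-endpoints-≡ M ends ⟩
      k * length M             ∎)
    (begin
      k * length M             ≡⟨ count-endpoints-≡ M ends ⟨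
      count p (endpoints G M)  ≤⟨ count≤∣p∣ unique p ⟩
      ∣ p ∣                    ∎)

  endsIn-matching : ∀ {W M} → IsMatchingIn G W M → ∀ {e} → e ∈ₗ M → endsIn W e ≡ 2
  endsIn-matching (edges , _) e∈M with All.lookup edges e∈M
  ... | _ , x∈W , y∈W = cong₂ _+_ (indicator-∈ x∈W) (indicator-∈ y∈W)

  2*length≤∣W∣ : ∀ {W M} → IsMatchingIn G W M → 2 * length M ≤ ∣ W ∣
  2*length≤∣W∣ {W} {M} M-matching = begin
    2 * length M             ≡⟨ count-endpoints-≡ M (endsIn-matching M-matching) ⟨
    count W (endpoints G M)  ≤⟨ count≤∣p∣ (proj₂ M-matching) W ⟩
    ∣ W ∣                    ∎

  perfect⇒maximum : ∀ {W M} → IsMatchingIn G W M → Covers M W → IsMaxMatchingIn G W M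
  perfect⇒maximum {W} {M} M-matching covers = M-matching , λ M′ M′-matching → *-cancelˡ-≤ 2 (begin
    2 * length M′  ≤⟨ 2*length≤∣W∣ M′-matching ⟩
    ∣ W ∣          ≡⟨ ∣p∣≡k*length (proj₂ M-matching) covers (endsIn-matching M-matching) ⟩
    2 * length M   ∎)

  MatchesInto : List (Fin n × Fin n) → Subset n → Subset n → Set
  MatchesInto M A B = Covers M A × (∀ {x y} → Mates M x y → x ∈ A → y ∈ B)

  matchesInto⇒∣≤∣ : ∀ {M A B} → Unique (endpoints G M) → MatchesInto M A B → ∣ A ∣ ≤ ∣ B ∣
  matchesInto⇒∣≤∣ {M} {A} {B} unique (covers , mate∈B) = begin
    ∣ A ∣                    ≤⟨ ∣p∣≤count _ A covers ⟩
    count A (endpoints G M)  ≤⟨ count-endpoints-mono M edgewise ⟩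
    count B (endpoints G M)  ≤⟨ count≤∣p∣ unique B ⟩
    ∣ B ∣                    ∎
    where
    edgewise : ∀ {e} → e ∈ₗ M → endsIn A e ≤ endsIn B e
    edgewise {x , y} xy∈M = begin
      indicator A x + indicator A y  ≤⟨ +-mono-≤ (indicator-mono (mate∈B (inj₁ xy∈M)))
                                                 (indicator-mono (mate∈B (inj₂ xy∈M))) ⟩
      indicator B y + indicator B x  ≡⟨ +-comm (indicator B y) (indicator B x) ⟩
      indicator B x + indicator B y  ∎

  endpoints-↾ : ∀ M {W} → (∀ {x y} → Mates M x y → x ∈ W → y ∈ W) →
                endpoints G (M ↾ W) ≡ filter (_∈? W) (endpoints G M)
  endpoints-↾ []            _      = refl
  endpoints-↾ ((x , y) ∷ M) {W} closed with x ∈? W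
  ... | yes x∈W with y ∈? W
  ...   | yes _   = cong (λ zs → x ∷ y ∷ zs) (endpoints-↾ M (closed ∘ Sum.map there there))
  ...   | no  y∉W = ⊥-elim (y∉W (closed (inj₁ (here refl)) x∈W))
  endpoints-↾ ((x , y) ∷ M) {W} closed | no x∉W with y ∈? W
  ...   | yes y∈W = ⊥-elim (x∉W (closed (inj₂ (here refl)) y∈W))
  ...   | no  _   = endpoints-↾ M (closed ∘ Sum.map there there)

  module _ {M W} (M-matching : IsMatchingIn G ⊤ M)
           (closed : ∀ {x y} → Mates M x y → x ∈ W → y ∈ W) where

    ↾-isMatching : IsMatchingIn G W (M ↾ W)
    ↾-isMatching = All.tabulate edge-in-W
                 , subst Unique (sym (endpoints-↾ M closed)) (Unique.filter⁺ (_∈? W) (proj₂ M-matching))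
      where
      edge-in-W : ∀ {e} → e ∈ₗ M ↾ W → Edge G (proj₁ e) (proj₂ e) × proj₁ e ∈ W × proj₂ e ∈ W
      edge-in-W e∈M↾W with ∈-filter⁻ (λ e → proj₁ e ∈? W) e∈M↾W
      ... | e∈M , x∈W = mates⇒edge M-matching (inj₁ e∈M) , x∈W , closed (inj₁ e∈M) x∈W

    ↾-covers : Covers M W → Covers (M ↾ W) W
    ↾-covers covers v v∈W =
      subst (v ∈ₗ_) (sym (endpoints-↾ M closed)) (∈-filter⁺ (_∈? W) (covers v v∈W) v∈W)

module _ {n : ℕ} (G : Graph n) {M : List (Fin n × Fin n)} {S : Subset n}
         (M-matching : IsMatchingIn G ⊤ M) (S-stable : IsStableIn G ⊤ S)
         (tight : ∣ S ∣ + length M ≡ n) where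

  open import Data.List.Membership.DecPropositional (_≟_ {n}) using () renaming (_∈?_ to _∈ₗ?_)

  private
    ∣∁S∣≡length : ∣ ∁ S ∣ ≡ length M
    ∣∁S∣≡length = begin-equality
      ∣ ∁ S ∣                        ≡⟨ ∣∁p∣≡n∸∣p∣ S ⟩
      n ∸ ∣ S ∣                      ≡⟨ cong (_∸ ∣ S ∣) tight ⟨
      ∣ S ∣ + length M ∸ ∣ S ∣       ≡⟨ m+n∸m≡n ∣ S ∣ (length M) ⟩
      length M                       ∎

    leaves-S : ∀ {e} → e ∈ₗ M → 1 ≤ endsIn (∁ S) e
    leaves-S {x , y} xy∈M with x ∈? S | y ∈? S
    ... | yes x∈S | yes y∈S = ⊥-elim (proj₂ S-stable x y x∈S y∈S (mates⇒edge G M-matching (inj₁ xy∈M)))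
    ... | no  x∉S | _       = ≤-trans (≤-reflexive (sym (indicator-∈ (x∉p⇒x∈∁p x∉S)))) (m≤m+n _ _)
    ... | yes _   | no  y∉S = ≤-trans (≤-reflexive (sym (indicator-∈ (x∉p⇒x∈∁p y∉S)))) (m≤n+m _ _)

    leaves-S-once : ∀ {e} → e ∈ₗ M → endsIn (∁ S) e ≡ 1
    leaves-S-once = endsIn≡1 G M leaves-S (begin
      count (∁ S) (endpoints G M)  ≤⟨ count≤∣p∣ (proj₂ M-matching) (∁ S) ⟩
      ∣ ∁ S ∣                      ≡⟨ ∣∁S∣≡length ⟩
      length M                     ∎)

  ∉⇒covered : ∀ {v} → v ∉ S → v ∈ₗ endpoints G M
  ∉⇒covered {v} v∉S =
    decidable-stable (v ∈ₗ? endpoints G M) (λ uncovered → <-irrefl refl (too-few uncovered))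
    where
    too-few : ¬ v ∈ₗ endpoints G M → length M < length M
    too-few uncovered = begin-strict
      length M                         ≤⟨ length≤count-endpoints G M leaves-S ⟩
      count (∁ S) (endpoints G M)      ≤⟨ count-mono (endpoints G M) avoid-v ⟩
      count (∁ S - v) (endpoints G M)  ≤⟨ count≤∣p∣ (proj₂ M-matching) (∁ S - v) ⟩
      ∣ ∁ S - v ∣                      <⟨ x∈p⇒∣p-x∣<∣p∣ (x∉p⇒x∈∁p v∉S) ⟩
      ∣ ∁ S ∣                          ≡⟨ ∣∁S∣≡length ⟩
      length M                         ∎
      where
      avoid-v : ∀ {x} → x ∈ₗ endpoints G M → x ∈ ∁ S → x ∈ ∁ S - v
      avoid-v x∈M x∈∁S = x∈p∧x≢y⇒x∈p-y x∈∁S λ { refl → uncovered x∈M }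

  mate-∉⇒∈ : ∀ {x y} → Mates M x y → x ∉ S → y ∈ S
  mate-∉⇒∈ (inj₁ xy∈M) x∉S = x∉∁p⇒x∈p (endsIn≡1⇒∉ʳ (leaves-S-once xy∈M) (x∉p⇒x∈∁p x∉S))
  mate-∉⇒∈ (inj₂ yx∈M) x∉S = x∉∁p⇒x∈p (endsIn≡1⇒∉ˡ (leaves-S-once yx∈M) (x∉p⇒x∈∁p x∉S))

module KönigEgerváryCore {n : ℕ} (G : Graph n) {M : List (Fin n × Fin n)}
                             (M-matching : IsMatchingIn G ⊤ M)
                             (tight : ∀ {S} → IsMaxStableIn G ⊤ S → ∣ S ∣ + length M ≡ n)
                             {C : Subset n} (C-core : IsCore G C) where

  open import Data.List.Membership.DecPropositional (_≟_ {n}) using () renaming (_∈?_ to _∈ₗ?_)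

  private
    unique : Unique (endpoints G M)
    unique = proj₂ M-matching

  core⊆maxStable : ∀ {S v} → IsMaxStableIn G ⊤ S → v ∈ C → v ∈ S
  core⊆maxStable S-max v∈C = proj₁ (C-core _) v∈C _ S-max

  N[core]∩maxStable≡∅ : ∀ {S v} → IsMaxStableIn G ⊤ S → v ∈ N G C → v ∉ S
  N[core]∩maxStable≡∅ S-max v∈N v∈S with ∈N⁻ G v∈N
  ... | u , u∈C , uv = proj₂ (proj₁ S-max) _ _ (core⊆maxStable S-max u∈C) v∈S uv

  -- An unmatched vertex lies in every maximum stable set, hence in the core.
  ∉core⇒covered : ∀ {v} → v ∉ C → v ∈ₗ endpoints G M
  ∉core⇒covered {v} v∉C = decidable-stable (v ∈ₗ? endpoints G M) λ uncovered →
    v∉C (proj₂ (C-core v) λ S S-max → decidable-stable (v ∈? S) λ v∉S →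
      uncovered (∉⇒covered G M-matching (proj₁ S-max) (tight S-max) v∉S))

  mate-∈N[core]⇒∈core : ∀ {x y} → Mates M x y → x ∈ N G C → y ∈ C
  mate-∈N[core]⇒∈core xy x∈N = proj₂ (C-core _) λ S S-max →
    mate-∉⇒∈ G M-matching (proj₁ S-max) (tight S-max) xy (N[core]∩maxStable≡∅ S-max x∈N)

  mate-∈core⇒∈N[core] : ∀ {x y} → Mates M x y → x ∈ C → y ∈ N G C
  mate-∈core⇒∈N[core] xy x∈C = ∈N⁺ G x∈C (mates⇒edge G M-matching xy)

  V₀ : Subset n
  V₀ = ⊤ ─ (C ∪ N G C)

  ∈V₀⁻ : ∀ {v} → v ∈ V₀ → v ∉ C × v ∉ N G C
  ∈V₀⁻ {v} v∈V₀ = (v∉C∪N ∘ x∈p∪q⁺ ∘ inj₁) , (v∉C∪N ∘ x∈p∪q⁺ ∘ inj₂)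
    where
    v∉C∪N : v ∉ C ∪ N G C
    v∉C∪N = proj₂ (x∈p─q⁻ ⊤ (C ∪ N G C) v∈V₀)

  ∈V₀⁺ : ∀ {v} → v ∉ C → v ∉ N G C → v ∈ V₀
  ∈V₀⁺ v∉C v∉N = x∈p∧x∉q⇒x∈p─q ∈⊤ (Sum.[ v∉C , v∉N ] ∘ x∈p∪q⁻ C (N G C))

  V₀-closed : ∀ {x y} → Mates M x y → x ∈ V₀ → y ∈ V₀
  V₀-closed xy x∈V₀ with ∈V₀⁻ x∈V₀
  ... | x∉C , x∉N = ∈V₀⁺ (x∉N ∘ mate-∈core⇒∈N[core] (swap xy)) (x∉C ∘ mate-∈N[core]⇒∈core (swap xy))

  M₀ : List (Fin n × Fin n)
  M₀ = M ↾ V₀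

  M₀-isMatching : IsMatchingIn G V₀ M₀
  M₀-isMatching = ↾-isMatching G M-matching V₀-closed

  M₀-perfect : Covers G M₀ V₀
  M₀-perfect = ↾-covers G M-matching V₀-closed (λ _ → ∉core⇒covered ∘ proj₁ ∘ ∈V₀⁻)

  G₀-hasPerfectMatching : HasPerfectMatchingIn G V₀
  G₀-hasPerfectMatching = M₀ , M₀-isMatching , M₀-perfect

  module _ {S : Subset n} (S-max : IsMaxStableIn G ⊤ S) where

    private
      S-stable : IsStableIn G ⊤ S
      S-stable = proj₁ S-max

      ∉S⇒covered : ∀ {v} → v ∉ S → v ∈ₗ endpoints G M
      ∉S⇒covered = ∉⇒covered G M-matching S-stable (tight S-max)

      mate-∉S⇒∈S : ∀ {x y} → Mates M x y → x ∉ S → y ∈ S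
      mate-∉S⇒∈S = mate-∉⇒∈ G M-matching S-stable (tight S-max)

      mate-∈S⇒∉S : ∀ {x y} → Mates M x y → x ∈ S → y ∉ S
      mate-∈S⇒∉S xy x∈S y∈S = proj₂ S-stable _ _ x∈S y∈S (mates⇒edge G M-matching xy)

      ∈V─S─N⁻ : ∀ {v} → v ∈ (⊤ ─ S) ─ N G C → v ∉ S × v ∉ N G C
      ∈V─S─N⁻ v∈ with x∈p─q⁻ (⊤ ─ S) (N G C) v∈
      ... | v∈V─S , v∉N = proj₂ (x∈p─q⁻ ⊤ S v∈V─S) , v∉N

    ∣N[core]∣≤∣core∣ : ∣ N G C ∣ ≤ ∣ C ∣
    ∣N[core]∣≤∣core∣ = matchesInto⇒∣≤∣ G unique
      ((λ _ → ∉S⇒covered ∘ N[core]∩maxStable≡∅ S-max) , mate-∈N[core]⇒∈core)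

    ∣S─core∣≡∣V─S─N[core]∣ : ∣ S ─ C ∣ ≡ ∣ (⊤ ─ S) ─ N G C ∣
    ∣S─core∣≡∣V─S─N[core]∣ = ≤-antisym
      (matchesInto⇒∣≤∣ G unique ((λ _ → ∉core⇒covered ∘ proj₂ ∘ x∈p─q⁻ S C) , into-V─S─N))
      (matchesInto⇒∣≤∣ G unique ((λ _ → ∉S⇒covered ∘ proj₁ ∘ ∈V─S─N⁻) , into-S─C))
      where
      into-V─S─N : ∀ {x y} → Mates M x y → x ∈ S ─ C → y ∈ (⊤ ─ S) ─ N G C
      into-V─S─N xy x∈S─C with x∈p─q⁻ S C x∈S─C
      ... | x∈S , x∉C = x∈p∧x∉q⇒x∈p─q (x∈p∧x∉q⇒x∈p─q ∈⊤ (mate-∈S⇒∉S xy x∈S))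
                                      (x∉C ∘ mate-∈N[core]⇒∈core (swap xy))
      into-S─C : ∀ {x y} → Mates M x y → x ∈ (⊤ ─ S) ─ N G C → y ∈ S ─ C
      into-S─C xy x∈ with ∈V─S─N⁻ x∈
      ... | x∉S , x∉N = x∈p∧x∉q⇒x∈p─q (mate-∉S⇒∈S xy x∉S) (x∉N ∘ mate-∈core⇒∈N[core] (swap xy))

    S─core⊆V₀ : ∀ {v} → v ∈ S ─ C → v ∈ V₀
    S─core⊆V₀ v∈S─C with x∈p─q⁻ S C v∈S─C
    ... | v∈S , v∉C = ∈V₀⁺ v∉C (λ v∈N → N[core]∩maxStable≡∅ S-max v∈N v∈S)

    core-stable : IsStableIn G ⊤ C
    core-stable = (λ _ _ → ∈⊤) , λ u v u∈C v∈C →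
      proj₂ S-stable u v (core⊆maxStable S-max u∈C) (core⊆maxStable S-max v∈C)

    S─core-maxStableIn-V₀ : IsMaxStableIn G V₀ (S ─ C)
    S─core-maxStableIn-V₀ = ((λ _ → S─core⊆V₀) , indep) , maximum
      where
      indep : ∀ u v → u ∈ S ─ C → v ∈ S ─ C → ¬ Edge G u v
      indep u v u∈ v∈ = proj₂ S-stable u v (proj₁ (x∈p─q⁻ S C u∈)) (proj₁ (x∈p─q⁻ S C v∈))
      maximum : ∀ T → IsStableIn G V₀ T → ∣ T ∣ ≤ ∣ S ─ C ∣
      maximum T (T⊆V₀ , T-indep) = +-cancelʳ-≤ ∣ C ∣ _ _ (begin
        ∣ T ∣ + ∣ C ∣      ≤⟨ ∣p∣+∣q∣≤∣p∪q∣ (proj₁ ∘ ∈V₀⁻ ∘ T⊆V₀ _) ⟩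
        ∣ T ∪ C ∣          ≤⟨ proj₂ S-max (T ∪ C) T∪C-stable ⟩
        ∣ S ∣              ≤⟨ ∣p∣≤∣p─q∣+∣q∣ S C ⟩
        ∣ S ─ C ∣ + ∣ C ∣  ∎)
        where
        T∪C-stable : IsStableIn G ⊤ (T ∪ C)
        T∪C-stable = stable-∪ G ((λ _ _ → ∈⊤) , T-indep) core-stable (proj₂ ∘ ∈V₀⁻ ∘ T⊆V₀ _)

    S─core-once : ∀ {e} → e ∈ₗ M₀ → endsIn (S ─ C) e ≡ 1
    S─core-once {x , y} xy∈M₀ with ∈-filter⁻ (λ e → proj₁ e ∈? V₀) xy∈M₀
    ... | xy∈M , x∈V₀ with x ∈? S
    ...   | yes x∈S = cong₂ _+_ (indicator-∈ (x∈p∧x∉q⇒x∈p─q x∈S (proj₁ (∈V₀⁻ x∈V₀))))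
                                (indicator-∉ (mate-∈S⇒∉S (inj₁ xy∈M) x∈S ∘ proj₁ ∘ x∈p─q⁻ S C))
    ...   | no  x∉S = cong₂ _+_ (indicator-∉ (x∉S ∘ proj₁ ∘ x∈p─q⁻ S C))
                                (indicator-∈ (x∈p∧x∉q⇒x∈p─q (mate-∉S⇒∈S (inj₁ xy∈M) x∉S)
                                                           (proj₁ (∈V₀⁻ (V₀-closed (inj₁ xy∈M) x∈V₀)))))

    G₀-isKE : IsKEIn G V₀
    G₀-isKE = S ─ C , M₀ , S─core-maxStableIn-V₀
            , perfect⇒maximum G M₀-isMatching M₀-perfect , α₀+μ₀≡∣V₀∣
      where
      ∣S─core∣≡length : ∣ S ─ C ∣ ≡ length M₀
      ∣S─core∣≡length = trans
        (∣p∣≡k*length G (proj₂ M₀-isMatching) (λ _ → M₀-perfect _ ∘ S─core⊆V₀) S─core-once)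
        (*-identityˡ (length M₀))
      ∣V₀∣≡2*length : ∣ V₀ ∣ ≡ 2 * length M₀
      ∣V₀∣≡2*length = ∣p∣≡k*length G (proj₂ M₀-isMatching) M₀-perfect (endsIn-matching G M₀-isMatching)
      α₀+μ₀≡∣V₀∣ : ∣ S ─ C ∣ + length M₀ ≡ ∣ V₀ ∣
      α₀+μ₀≡∣V₀∣ = begin-equality
        ∣ S ─ C ∣ + length M₀  ≡⟨ cong (_+ length M₀) ∣S─core∣≡length ⟩
        length M₀ + length M₀  ≡⟨ cong (length M₀ +_) (+-identityʳ (length M₀)) ⟨
        2 * length M₀          ≡⟨ ∣V₀∣≡2*length ⟨
        ∣ V₀ ∣                 ∎

proposition3p2 : {n : ℕ} (G : Graph n) → IsGraph G → IsKE G →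
    (C : Subset n) → IsCore G C →
    (S : Subset n) → IsMaxStableIn G ⊤ S →
    (∣ N G C ∣ ≤ ∣ C ∣)
    × (∣ S ─ C ∣ ≡ ∣ (⊤ ─ S) ─ N G C ∣)
    × (HasPerfectMatchingIn G (⊤ ─ (C ∪ N G C)) × IsKEIn G (⊤ ─ (C ∪ N G C)))
proposition3p2 {n} G _ (S* , M , S*-max , (M-matching , _) , α+μ≡∣V∣) C C-core S S-max =
  ∣N[core]∣≤∣core∣ S-max , ∣S─core∣≡∣V─S─N[core]∣ S-max , G₀-hasPerfectMatching , G₀-isKE S-max
  where
  tight : ∀ {S′} → IsMaxStableIn G ⊤ S′ → ∣ S′ ∣ + length M ≡ n
  tight S′-max =
    trans (cong (_+ length M) (maxStable-size G S′-max S*-max)) (trans α+μ≡∣V∣ (∣⊤∣≡n n))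
  open KönigEgerváryCore G M-matching tight C-core
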